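{- Let $\mathbf{E}$ be a constructor space, let $S$ be an $\mathbf{E}$-sketch, and let $\mathcal{C}=\mathrm{CatTh}[\mathbf{E},S]$ be its categorial theory. Let $$A \xrightarrow{\;f\;} B \xleftarrow{\;j\;} C$$ be a potential factorization in $\mathcal{C}$, i.e. a pair of arrows $f\colon A\to B$ (the hypothesis construction) and $j\colon C\to B$ (the claim construction) with common codomain $B$. Then the potential factorization is deducible if and only if it is valid. That is: there exists an arrow $v\colon A\to C$ in $\mathcal{C}$ with $j\circ v=f$ if and only if for every model $\mathfrak{M}\colon\mathcal{C}\to\mathbf{Set}$ there exists a function $\xi\colon\mathfrak{M}(A)\to\mathfrak{M}(C)$ with $\mathfrak{M}(j)\circ\xi=\mathfrak{M}(f)$.
   Context: Fix a finite-limit sketch $\mathit{Cat}$ whose models in $\mathbf{Set}$ are the small categories. A constructor space sketch is a finite-limit sketch $E$ together with a sketch morphism $\eta\colon\mathit{Cat}\to E$ such that every object of the finite-limit category $\mathrm{CatTh}[\mathbf{FinLim},E]$ (the finite-limit theory generated by $E$) is the limit of a finite diagram whose nodes are images under $\mathrm{CatTh}[\mathbf{FinLim},\eta]$ of nodes of $\mathit{Cat}$; the category $\mathbf{E}=\mathrm{CatTh}[\mathbf{FinLim},E]$ is then called a constructor space, and finite-limit-preserving functors $\mathbf{E}\to\mathbf{Set}$ are called $\mathbf{E}$-categories (morphisms of them are $\mathbf{E}$-functors). An $\mathbf{E}$-sketch is a global element $S\colon 1\to v$ freely adjoined to some object $v$ of $\mathbf{E}$, producing a finite-limit theory $\mathbf{E}[S]$;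 the categorial theory $\mathrm{CatTh}[\mathbf{E},S]$ is the ($\mathbf{E}$-category underlying the) initial model of $\mathbf{E}[S]$, regarded as a category. A model of $\mathcal{C}=\mathrm{CatTh}[\mathbf{E},S]$ here means a functor $\mathcal{C}\to\mathbf{Set}$ preserving the finite limits that exist in $\mathcal{C}$; in particular every representable functor $\mathrm{Hom}(A,-)$ is a model. A potential factorization $A\xrightarrow{f}B\xleftarrow{j}C$ is deducible if some $v\colon A\to C$ satisfies $j\circ v=f$, and valid if every model $\mathfrak{M}$ admits a function $\xi$ with $\mathfrak{M}(j)\circ\xi=\mathfrak{M}(f)$. -}

module Defs where

open import Level using (Level; suc; _⊔_; 0ℓ)
open import Data.Nat using (ℕ)
open import Data.Fin using (Fin)
open import Data.Product using (Σ; _×_; _,_; ∃)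
open import Relation.Binary.Bundles using (Setoid)
open import Function.Bundles using (Func; _⟨$⟩_)

record Category (o ℓ e : Level) : Set (suc (o ⊔ ℓ ⊔ e)) where
  infixr 9 _∘_
  infix 4 _≈_
  field
    Obj : Set o
    _⇒_ : Obj → Obj → Set ℓ
    _≈_ : ∀ {A B} → A ⇒ B → A ⇒ B → Set e
    id  : ∀ {A} → A ⇒ A
    _∘_ : ∀ {A B C} → B ⇒ C → A ⇒ B → A ⇒ C
    ≈-refl  : ∀ {A B} {f : A ⇒ B} → f ≈ f
    ≈-sym   : ∀ {A B} {f g : A ⇒ B} → f ≈ g → g ≈ f
    ≈-trans : ∀ {A B} {f g h : A ⇒ B} → f ≈ g → g ≈ h → f ≈ h
    ∘-resp-≈ : ∀ {A B C} {f h : B ⇒ C} {g i : A ⇒ B} → f ≈ h → g ≈ i → f ∘ g ≈ h ∘ i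
    identityˡ : ∀ {A B} {f : A ⇒ B} → id ∘ f ≈ f
    identityʳ : ∀ {A B} {f : A ⇒ B} → f ∘ id ≈ f
    assoc : ∀ {A B C D} {f : A ⇒ B} {g : B ⇒ C} {h : C ⇒ D} →
            (h ∘ g) ∘ f ≈ h ∘ (g ∘ f)

-- Finite diagrams: indexed by a finite graph with n vertices and m edges.
-- (Limits of diagrams over finite graphs are exactly the finite limits.)
module _ {o ℓ e : Level} (𝒞 : Category o ℓ e) where
  open Category 𝒞

  record FinDiagram : Set (o ⊔ ℓ) where
    field
      nV nE : ℕ
      src tgt : Fin nE → Fin nV
      obj : Fin nV → Obj
      arr : (k : Fin nE) → obj (src k) ⇒ obj (tgt k)

  record Cone (D : FinDiagram) : Set (o ⊔ ℓ ⊔ e) where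
    open FinDiagram D
    field
      apex : Obj
      leg  : (i : Fin nV) → apex ⇒ obj i
      commute : (k : Fin nE) → arr k ∘ leg (src k) ≈ leg (tgt k)

  IsLimit : {D : FinDiagram} → Cone D → Set (o ⊔ ℓ ⊔ e)
  IsLimit {D} L =
    (K : Cone D) →
    Σ (Cone.apex K ⇒ Cone.apex L) λ u →
      ((i : Fin (FinDiagram.nV D)) → Cone.leg L i ∘ u ≈ Cone.leg K i) ×
      ((w : Cone.apex K ⇒ Cone.apex L) →
        ((i : Fin (FinDiagram.nV D)) → Cone.leg L i ∘ w ≈ Cone.leg K i) → w ≈ u)

SetCat : Category (suc 0ℓ) 0ℓ 0ℓ
SetCat = record
  { Obj = Setoid 0ℓ 0ℓ
  ; _⇒_ = Func
  ; _≈_ = λ {A} {B} f g → ∀ x → Setoid._≈_ B (f ⟨$⟩ x) (g ⟨$⟩ x)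
  ; id  = λ {A} → record { to = λ x → x ; cong = λ p → p }
  ; _∘_ = λ f g → record { to = λ x → f ⟨$⟩ (g ⟨$⟩ x) ; cong = λ p → Func.cong f (Func.cong g p) }
  ; ≈-refl = λ {A} {B} x → Setoid.refl B
  ; ≈-sym = λ {A} {B} p x → Setoid.sym B (p x)
  ; ≈-trans = λ {A} {B} p q x → Setoid.trans B (p x) (q x)
  ; ∘-resp-≈ = λ {A} {B} {C} {f} {h} {g} {i} p q x → Setoid.trans C (Func.cong f (q x)) (p (i ⟨$⟩ x))
  ; identityˡ = λ {A} {B} x → Setoid.refl B
  ; identityʳ = λ {A} {B} x → Setoid.refl B
  ; assoc = λ {A} {B} {C} {D} x → Setoid.refl D
  }

record Functor {o ℓ e o′ ℓ′ e′ : Level}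
               (𝒞 : Category o ℓ e) (𝒟 : Category o′ ℓ′ e′)
               : Set (o ⊔ ℓ ⊔ e ⊔ o′ ⊔ ℓ′ ⊔ e′) where
  private
    module C = Category 𝒞
    module D = Category 𝒟
  field
    F₀ : C.Obj → D.Obj
    F₁ : ∀ {A B} → A C.⇒ B → F₀ A D.⇒ F₀ B
    F-resp-≈ : ∀ {A B} {f g : A C.⇒ B} → f C.≈ g → F₁ f D.≈ F₁ g
    identity : ∀ {A} → F₁ (C.id {A}) D.≈ D.id
    homomorphism : ∀ {A B C} {f : A C.⇒ B} {g : B C.⇒ C} →
                   F₁ (g C.∘ f) D.≈ F₁ g D.∘ F₁ f

module _ {o ℓ e o′ ℓ′ e′ : Level} {𝒞 : Category o ℓ e} {𝒟 : Category o′ ℓ′ e′}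
         (F : Functor 𝒞 𝒟) where
  open Functor F
  private
    module C = Category 𝒞
    module D = Category 𝒟

  mapDiagram : FinDiagram 𝒞 → FinDiagram 𝒟
  mapDiagram Dg = record
    { nV = FinDiagram.nV Dg ; nE = FinDiagram.nE Dg
    ; src = FinDiagram.src Dg ; tgt = FinDiagram.tgt Dg
    ; obj = λ i → F₀ (FinDiagram.obj Dg i)
    ; arr = λ k → F₁ (FinDiagram.arr Dg k) }

  mapCone : {Dg : FinDiagram 𝒞} → Cone 𝒞 Dg → Cone 𝒟 (mapDiagram Dg)
  mapCone {Dg} K = record
    { apex = F₀ (Cone.apex K)
    ; leg = λ i → F₁ (Cone.leg K i)
    ; commute = λ k → D.≈-trans (D.≈-sym homomorphism) (F-resp-≈ (Cone.commute K k)) }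

  PreservesFiniteLimits : Set (o ⊔ ℓ ⊔ e ⊔ o′ ⊔ ℓ′ ⊔ e′)
  PreservesFiniteLimits =
    (Dg : FinDiagram 𝒞) (L : Cone 𝒞 Dg) → IsLimit 𝒞 L → IsLimit 𝒟 (mapCone L)

record Model (𝒞 : Category 0ℓ 0ℓ 0ℓ) : Set (suc 0ℓ) where
  field
    functor   : Functor 𝒞 SetCat
    preserves : PreservesFiniteLimits functor
  open Functor functor public

module _ (𝒞 : Category 0ℓ 0ℓ 0ℓ) where
  open Category 𝒞

  Deducible : {A B C : Obj} → A ⇒ B → C ⇒ B → Set
  Deducible {A} {B} {C} f j = Σ (A ⇒ C) λ v → j ∘ v ≈ f

  -- ξ is an arbitrary function between the underlying sets.
  Valid : {A B C : Obj} → A ⇒ B → C ⇒ B → Set (suc 0ℓ)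
  Valid {A} {B} {C} f j =
    (𝔐 : Model 𝒞) →
    Σ (Setoid.Carrier (Model.F₀ 𝔐 A) → Setoid.Carrier (Model.F₀ 𝔐 C)) λ ξ →
      (x : Setoid.Carrier (Model.F₀ 𝔐 A)) →
      Setoid._≈_ (Model.F₀ 𝔐 B) (Model.F₁ 𝔐 j ⟨$⟩ ξ x) (Model.F₁ 𝔐 f ⟨$⟩ x)

module Submission where

open import Defs
open import Level using (0ℓ)
open import Function.Bundles using (_⇔_; mk⇔; Func; _⟨$⟩_)
open import Data.Fin using (Fin)
open import Data.Product using (_,_; proj₁; proj₂)
open import Relation.Binary.Bundles using (Setoid)

-- Validity in all models gives deducibility already from the single representable
-- model Hom(A, -): evaluating its witness ξ at id_A produces the arrow v (Yoneda).

module Representable (𝒞 : Category 0ℓ 0ℓ 0ℓ) (A : Category.Obj 𝒞) where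
  open Category 𝒞

  homSetoid : Obj → Setoid 0ℓ 0ℓ
  homSetoid X = record
    { Carrier = A ⇒ X ; _≈_ = _≈_
    ; isEquivalence = record { refl = ≈-refl ; sym = ≈-sym ; trans = ≈-trans } }

  homFunctor : Functor 𝒞 SetCat
  homFunctor = record
    { F₀ = homSetoid
    ; F₁ = λ g → record { to = g ∘_ ; cong = ∘-resp-≈ ≈-refl }
    ; F-resp-≈ = λ p _ → ∘-resp-≈ p ≈-refl
    ; identity = λ _ → identityˡ
    ; homomorphism = λ _ → assoc
    }

  elementCone : {D : FinDiagram 𝒞} (K : Cone SetCat (mapDiagram homFunctor D)) →
                Setoid.Carrier (Cone.apex K) → Cone 𝒞 D
  elementCone K x = record
    { apex = A
    ; leg = λ i → Cone.leg K i ⟨$⟩ x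
    ; commute = λ k → Cone.commute K k x }

  -- Limits in Set are computed pointwise: an element of a cone's apex is a cone with apex A.
  homFunctor-preservesFiniteLimits : PreservesFiniteLimits homFunctor
  homFunctor-preservesFiniteLimits D L isLimit K = mediator , mediate-factors , unique
    where
      open FinDiagram D using (nV)
      module K = Setoid (Cone.apex K)

      mediate : K.Carrier → A ⇒ Cone.apex L
      mediate x = proj₁ (isLimit (elementCone K x))

      mediate-factors : (i : Fin nV) → ∀ x → Cone.leg L i ∘ mediate x ≈ Cone.leg K i ⟨$⟩ x
      mediate-factors i x = proj₁ (proj₂ (isLimit (elementCone K x))) i

      mediate-unique : ∀ {x} (w : A ⇒ Cone.apex L) →
                       (∀ i → Cone.leg L i ∘ w ≈ Cone.leg K i ⟨$⟩ x) → w ≈ mediate x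
      mediate-unique {x} = proj₂ (proj₂ (isLimit (elementCone K x)))

      mediator : Func (Cone.apex K) (homSetoid (Cone.apex L))
      mediator = record
        { to = mediate
        ; cong = λ {x} {y} x≈y → mediate-unique (mediate x)
            (λ i → ≈-trans (mediate-factors i x) (Func.cong (Cone.leg K i) x≈y)) }

      unique : (w : Func (Cone.apex K) (homSetoid (Cone.apex L))) →
               ((i : Fin nV) → ∀ x → Cone.leg L i ∘ (w ⟨$⟩ x) ≈ Cone.leg K i ⟨$⟩ x) →
               ∀ x → w ⟨$⟩ x ≈ mediate x
      unique w w-factors x = mediate-unique (w ⟨$⟩ x) (λ i → w-factors i x)

  representableModel : Model 𝒞
  representableModel = record
    { functor = homFunctor ; preserves = homFunctor-preservesFiniteLimits }

module _ (𝒞 : Category 0ℓ 0ℓ 0ℓ) {A B C : Category.Obj 𝒞}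
         (f : Category._⇒_ 𝒞 A B) (j : Category._⇒_ 𝒞 C B) where
  open Category 𝒞

  deducible⇒valid : Deducible 𝒞 f j → Valid 𝒞 f j
  deducible⇒valid (v , j∘v≈f) 𝔐 = (F₁ v ⟨$⟩_) , λ x →
    trans (sym (homomorphism {f = v} {g = j} x)) (F-resp-≈ j∘v≈f x)
    where
      open Model 𝔐
      open Setoid (F₀ B) using (sym; trans)

  valid⇒deducible : Valid 𝒞 f j → Deducible 𝒞 f j
  valid⇒deducible valid = ξ id , ≈-trans (ξ-factors id) identityʳ
    where
      open Representable 𝒞 A using (representableModel)
      ξ = proj₁ (valid representableModel)
      ξ-factors = proj₂ (valid representableModel)

theorem6p2p1 : (𝒞 : Category 0ℓ 0ℓ 0ℓ) {A B C : Category.Obj 𝒞}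
    (f : Category._⇒_ 𝒞 A B) (j : Category._⇒_ 𝒞 C B) →
    Deducible 𝒞 f j ⇔ Valid 𝒞 f j
theorem6p2p1 𝒞 f j = mk⇔ (deducible⇒valid 𝒞 f j) (valid⇒deducible 𝒞 f j)
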